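{- Let $G=(V,E)$ be a finite simple graph and let $W\subseteq V$ satisfy $2\le |W|\le |V|-2$. Then $W$ is isolable if and only if for all distinct $a,b\in W$ and all distinct $c,d\in V\setminus W$ the number $N(a,b;c,d)$ is even.
   Context: For four vertices $a,b,c,d$ of $G$, $N(a,b;c,d)$ denotes the number of pairs among $\{a,c\},\{a,d\},\{b,c\},\{b,d\}$ that are edges of $G$. For $U\subseteq V$ (possibly empty or equal to $V$), the $U$-switching of $G$ is $G_U=(V,E\,\triangle\,E_{U,V\setminus U})$, where $E_{U,V\setminus U}$ is the edge set of the complete bipartite graph on $V$ with parts $U$ and $V\setminus U$. A set $W\subseteq V$ is isolable if $2\le|W|\le|V|-2$ and some switching $G_U$ contains no edge joining $W$ and $V\setminus W$. -}

module Defs where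

open import Data.Nat using (ℕ; _+_; _≤_; _∸_)
open import Data.Nat.Divisibility using (_∣_)
open import Data.Bool using (Bool; true; false; _xor_; if_then_else_)
open import Data.Fin using (Fin)
open import Data.Fin.Subset using (Subset; _∈_; _∉_; ∣_∣)
open import Data.Vec using (lookup)
open import Data.Product using (Σ; _×_)
open import Relation.Binary.PropositionalEquality using (_≡_; _≢_)

record Graph (n : ℕ) : Set where
  field
    adj     : Fin n → Fin n → Bool
    sym     : ∀ x y → adj x y ≡ adj y x
    irrefl  : ∀ x → adj x x ≡ false
open Graph public

edge : ∀ {n} → Graph n → Fin n → Fin n → ℕ
edge G x y = if adj G x y then 1 else 0

N : ∀ {n} → Graph n → Fin n → Fin n → Fin n → Fin n → ℕ
N G a b c d = edge G a c + edge G a d + edge G b c + edge G b d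

-- adjacency of the U-switching G_U : E △ E_{U, V∖U}
-- ({x,y} is in E_{U,V∖U} iff exactly one of x,y lies in U)
switchAdj : ∀ {n} → Graph n → Subset n → Fin n → Fin n → Bool
switchAdj G U x y = adj G x y xor (lookup U x xor lookup U y)

Isolable : ∀ {n} → Graph n → Subset n → Set
Isolable {n} G W =
  (2 ≤ ∣ W ∣) × (∣ W ∣ ≤ n ∸ 2) ×
  Σ (Subset n) (λ U → ∀ x y → x ∈ W → y ∉ W → switchAdj G U x y ≡ false)

EvenCondition : ∀ {n} → Graph n → Subset n → Set
EvenCondition G W =
  ∀ a b c d → a ∈ W → b ∈ W → a ≢ b → c ∉ W → d ∉ W → c ≢ d →
  2 ∣ N G a b c d

-- Working over GF(2), a switching U adds u x + u y to the adjacency bit of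
-- {x, y}, where u is the indicator of U.  Hence the parity of N(a,b;c,d),
-- i.e. the XOR of the four adjacency bits around the 4-cycle a c b d, is
-- invariant under switching, and it vanishes when no edge crosses between W
-- and V ∖ W.  Conversely, if it always vanishes, fix a ∈ W and c ∉ W and put
-- u x = adj x c on W and u y = adj a y + adj a c off W: the switched
-- adjacency bit of x ∈ W, y ∉ W is then the XOR around the 4-cycle x y a c,
-- which is 0 (trivially so when x = a or y = c).
module Submission where

open import Defs
open import Data.Nat using (ℕ; _≤_; _∸_)
open import Data.Fin.Subset using (Subset; ∣_∣)
open import Function.Bundles using (_⇔_)

open import Data.Bool using (Bool; true; false; _xor_; _∧_; if_then_else_)
open import Data.Bool.Solver using (module xor-∧-Solver)
open import Data.Fin using (Fin; _≟_)
open import Data.Fin.Subset using (_∈_; _∉_; ∁; Nonempty)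
open import Data.Fin.Subset.Properties using (nonempty?; Empty-unique; ∣⊥∣≡0; ∣∁p∣≡n∸∣p∣; x∈∁p⇒x∉p)
open import Data.Nat using (_<_; _+_; _*_; z≤n; s≤s)
open import Data.Nat.Divisibility using (_∣_; ∣1⇒≡1; _∣0; ∣m∣n⇒∣m+n; ∣m+n∣m⇒∣n; m∣m*n)
open import Data.Nat.Properties
  using (+-assoc; +-comm; >⇒≢; <-≤-trans; m<n⇒0<n∸m; m∸n≤m; ≤-trans; m<m+n; m≤o∸n⇒m+n≤o)
open import Data.Product using (∃; _,_; map₂)
open import Data.Vec using (lookup; tabulate)
open import Data.Vec.Properties using ([]=⇒lookup; lookup⇒[]=; lookup∘tabulate)
open import Function.Bundles using (mk⇔; Equivalence)
open import Function.Base using (_⟨_⟩_)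
open import Function.Properties.Equivalence using () renaming (trans to ⇔-trans)
open import Relation.Binary.PropositionalEquality
  using (_≡_; refl; trans; cong; cong₂; subst; module ≡-Reasoning)
import Relation.Binary.PropositionalEquality as ≡
open import Relation.Nullary using (yes; no; contradiction)

open Equivalence using (to; from)

bit : Bool → ℕ
bit b = if b then 1 else 0

bit+bit≡bit-xor+2*bit-∧ : ∀ p q → bit p + bit q ≡ bit (p xor q) + 2 * bit (p ∧ q)
bit+bit≡bit-xor+2*bit-∧ false false = refl
bit+bit≡bit-xor+2*bit-∧ false true  = refl
bit+bit≡bit-xor+2*bit-∧ true  false = refl
bit+bit≡bit-xor+2*bit-∧ true  true  = refl

2∣m+2*k⇔2∣m : ∀ m k → (2 ∣ m + 2 * k) ⇔ (2 ∣ m)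
2∣m+2*k⇔2∣m m k = mk⇔
  (λ 2∣m+2k → ∣m+n∣m⇒∣n (subst (2 ∣_) (+-comm m (2 * k)) 2∣m+2k) (m∣m*n k))
  (λ 2∣m → ∣m∣n⇒∣m+n 2∣m (m∣m*n k))

2∣m+bit+bit⇔2∣m+bit-xor : ∀ m p q → (2 ∣ m + bit p + bit q) ⇔ (2 ∣ m + bit (p xor q))
2∣m+bit+bit⇔2∣m+bit-xor m p q =
  subst (λ x → (2 ∣ x) ⇔ (2 ∣ m + bit (p xor q))) (≡.sym carry) (2∣m+2*k⇔2∣m _ (bit (p ∧ q)))
  where
  open ≡-Reasoning
  carry : m + bit p + bit q ≡ m + bit (p xor q) + 2 * bit (p ∧ q)
  carry = begin
    m + bit p + bit q                      ≡⟨ +-assoc m (bit p) (bit q) ⟩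
    m + (bit p + bit q)                    ≡⟨ cong (m +_) (bit+bit≡bit-xor+2*bit-∧ p q) ⟩
    m + (bit (p xor q) + 2 * bit (p ∧ q))  ≡⟨ ≡.sym (+-assoc m _ _) ⟩
    m + bit (p xor q) + 2 * bit (p ∧ q)    ∎

2∣bit⇔≡false : ∀ b → (2 ∣ bit b) ⇔ (b ≡ false)
2∣bit⇔≡false false = mk⇔ (λ _ → refl) (λ _ → 2 ∣0)
2∣bit⇔≡false true  = mk⇔ (λ 2∣1 → contradiction (∣1⇒≡1 2∣1) λ ()) λ ()

2∣sum-bits⇔xor≡false : ∀ p q r s →
  (2 ∣ bit p + bit q + bit r + bit s) ⇔ (p xor q xor r xor s ≡ false)
-- The third step is the case m = 0, where 0 + bit p reduces to bit p.
2∣sum-bits⇔xor≡false p q r s =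
  2∣m+bit+bit⇔2∣m+bit-xor (bit p + bit q) r s ⟨ ⇔-trans ⟩
  2∣m+bit+bit⇔2∣m+bit-xor (bit p) q (r xor s) ⟨ ⇔-trans ⟩
  2∣m+bit+bit⇔2∣m+bit-xor 0 p (q xor r xor s) ⟨ ⇔-trans ⟩
  2∣bit⇔≡false (p xor q xor r xor s)

2≤m≤n∸2⇒m<n : ∀ {m n} → 2 ≤ m → m ≤ n ∸ 2 → m < n
2≤m≤n∸2⇒m<n {m} {n} 2≤m m≤n∸2 =
  <-≤-trans (m<m+n m (s≤s z≤n)) (m≤o∸n⇒m+n≤o m 2≤n m≤n∸2)
  where
  2≤n : 2 ≤ n
  2≤n = ≤-trans 2≤m (≤-trans m≤n∸2 (m∸n≤m n 2))

module _ {A : Set} where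

  cycleXor : (A → A → Bool) → A → A → A → A → Bool
  cycleXor R a b c d = R a c xor R a d xor R b c xor R b d

  open xor-∧-Solver

  cycleXor-switch : ∀ (R : A → A → Bool) (u : A → Bool) a b c d →
    cycleXor (λ x y → R x y xor (u x xor u y)) a b c d ≡ cycleXor R a b c d
  cycleXor-switch R u a b c d = solve 8
    (λ p q r s ua ub uc ud →
      (p :+ (ua :+ uc)) :+ ((q :+ (ua :+ ud)) :+ ((r :+ (ub :+ uc)) :+ (s :+ (ub :+ ud))))
      := p :+ (q :+ (r :+ s)))
    refl (R a c) (R a d) (R b c) (R b d) (u a) (u b) (u c) (u d)

  cycleXor-diagˡ : ∀ (R : A → A → Bool) a c d → cycleXor R a a c d ≡ false
  cycleXor-diagˡ R a c d =
    solve 2 (λ p q → p :+ (q :+ (p :+ q)) := con false) refl (R a c) (R a d)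

  cycleXor-diagʳ : ∀ (R : A → A → Bool) a b c → cycleXor R a b c c ≡ false
  cycleXor-diagʳ R a b c =
    solve 2 (λ p q → p :+ (p :+ (q :+ q)) := con false) refl (R a c) (R b c)

2∣N⇔cycleXor≡false : ∀ {n} (G : Graph n) a b c d →
  (2 ∣ N G a b c d) ⇔ (cycleXor (adj G) a b c d ≡ false)
2∣N⇔cycleXor≡false G a b c d =
  2∣sum-bits⇔xor≡false (adj G a c) (adj G a d) (adj G b c) (adj G b d)

0<∣p∣⇒Nonempty : ∀ {n} (p : Subset n) → 0 < ∣ p ∣ → Nonempty p
0<∣p∣⇒Nonempty {n} p 0<∣p∣ with nonempty? p
... | yes p≢∅ = p≢∅
... | no  p≡∅ = contradiction (trans (cong ∣_∣ (Empty-unique p≡∅)) (∣⊥∣≡0 n)) (>⇒≢ 0<∣p∣)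

∣p∣<n⇒∃∉ : ∀ {n} (p : Subset n) → ∣ p ∣ < n → ∃ (_∉ p)
∣p∣<n⇒∃∉ p ∣p∣<n = map₂ x∈∁p⇒x∉p (0<∣p∣⇒Nonempty (∁ p) 0<∣∁p∣)
  where
  0<∣∁p∣ : 0 < ∣ ∁ p ∣
  0<∣∁p∣ = subst (0 <_) (≡.sym (∣∁p∣≡n∸∣p∣ p)) (m<n⇒0<n∸m ∣p∣<n)

x∉p⇒lookup≡false : ∀ {n} {p : Subset n} {x} → x ∉ p → lookup p x ≡ false
x∉p⇒lookup≡false {p = p} {x} x∉p with lookup p x in eq
... | true  = contradiction (lookup⇒[]= x p eq) x∉p
... | false = refl

module _ {n} (G : Graph n) (W : Subset n) where

  switchingBit : Fin n → Fin n → Fin n → Bool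
  switchingBit a c x = if lookup W x then adj G x c else adj G a x xor adj G a c

  switchingSet : Fin n → Fin n → Subset n
  switchingSet a c = tabulate (switchingBit a c)

  switchAdj-switchingSet : ∀ {a c x y} → x ∈ W → y ∉ W →
    switchAdj G (switchingSet a c) x y ≡ cycleXor (adj G) x a y c
  switchAdj-switchingSet {a} {c} {x} {y} x∈W y∉W
    rewrite lookup∘tabulate (switchingBit a c) x | lookup∘tabulate (switchingBit a c) y
          | []=⇒lookup x∈W | x∉p⇒lookup≡false y∉W
    = refl

  isolable⇒even : Isolable G W → EvenCondition G W
  isolable⇒even (_ , _ , U , noCrossing) a b c d a∈W b∈W _ c∉W d∉W _ =
    from (2∣N⇔cycleXor≡false G a b c d) (begin
      cycleXor (adj G) a b c d               ≡⟨ ≡.sym (cycleXor-switch (adj G) (lookup U) a b c d) ⟩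
      cycleXor (switchAdj G U) a b c d       ≡⟨ cong₂ _xor_ (noCrossing a c a∈W c∉W)
                                                 (cong₂ _xor_ (noCrossing a d a∈W d∉W)
                                                   (cong₂ _xor_ (noCrossing b c b∈W c∉W) (noCrossing b d b∈W d∉W))) ⟩
      false                                  ∎)
    where open ≡-Reasoning

  even⇒cycleXor≡false : EvenCondition G W → ∀ {a b c d} → a ∈ W → b ∈ W → c ∉ W → d ∉ W →
    cycleXor (adj G) a b c d ≡ false
  even⇒cycleXor≡false even {a} {b} {c} {d} a∈W b∈W c∉W d∉W with a ≟ b | c ≟ d
  ... | yes refl | _        = cycleXor-diagˡ (adj G) a c d
  ... | no  _    | yes refl = cycleXor-diagʳ (adj G) a b c
  ... | no  a≢b  | no  c≢d  = to (2∣N⇔cycleXor≡false G a b c d) (even a b c d a∈W b∈W a≢b c∉W d∉W c≢d)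

  even⇒noCrossing : EvenCondition G W → ∀ {a c} → a ∈ W → c ∉ W →
    ∀ x y → x ∈ W → y ∉ W → switchAdj G (switchingSet a c) x y ≡ false
  even⇒noCrossing even {a} {c} a∈W c∉W x y x∈W y∉W = begin
    switchAdj G (switchingSet a c) x y  ≡⟨ switchAdj-switchingSet x∈W y∉W ⟩
    cycleXor (adj G) x a y c            ≡⟨ even⇒cycleXor≡false even x∈W a∈W y∉W c∉W ⟩
    false                               ∎
    where open ≡-Reasoning

lemma1 : ∀ (n : ℕ) (G : Graph n) (W : Subset n) →
    2 ≤ ∣ W ∣ → ∣ W ∣ ≤ n ∸ 2 →
    Isolable G W ⇔ EvenCondition G W
lemma1 n G W 2≤∣W∣ ∣W∣≤n∸2 = mk⇔ (isolable⇒even G W) λ even →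
  let a , a∈W = 0<∣p∣⇒Nonempty W (<-≤-trans (s≤s z≤n) 2≤∣W∣)
      c , c∉W = ∣p∣<n⇒∃∉ W (2≤m≤n∸2⇒m<n 2≤∣W∣ ∣W∣≤n∸2)
  in 2≤∣W∣ , ∣W∣≤n∸2 , switchingSet G W a c , even⇒noCrossing G W even a∈W c∉W
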